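{- Let $M=(W,\succeq_N,\succeq_I,v)$ be an $\mathbf{R}$-ordered model, $A$ a Boolean formula and $w_1\in W$ with $M,w_1\models A$. Then either $w_1\in\max_{\succeq_N}(\Vert A\Vert)$, or there exists $w_2\in W$ with $w_2\succ_N w_1$ and $w_2\in\max_{\succeq_N}(\Vert A\Vert)$.
   Context: Formulas: Boolean formulas over propositional letters; normality conditionals $A\Rightarrow B$ and obligations $\bigcirc(B/A)$ with $A,B$ Boolean (body $A$, head $B$); alethic formulas built with $\Box$ over Boolean formulas. $\mathbf{R}=(\mathbf{R}^{\Rightarrow},\mathbf{R}^{\mathrm{o}})$ with $\mathbf{R}^{\Rightarrow}$ a finite set of normality conditionals and $\mathbf{R}^{\mathrm{o}}$ a finite set of obligations. Normality ranking: for $X\subseteq\mathbf{R}^{\Rightarrow}$, $\mathrm{m}(X)=\{B\rightarrow C: B\Rightarrow C\in X\}$, $\varepsilon(X)=\{A\Rightarrow B\in\mathbf{R}^{\Rightarrow}:\mathrm{m}(X)\models_{\mathrm{PL}}\neg A\}$; $\mathcal{E}_0=\mathbf{R}^{\Rightarrow}$, $\mathcal{E}_i=\varepsilon(\mathcal{E}_{i-1})$; $m$ is the least $k$ with $\mathcal{E}_l=\mathcal{E}_k$ for all $l>k$; $\Delta_i=\mathcal{E}_i\setminus\mathcal{E}_{i+1}$ for $0\le i<m$ and $\Delta_m=\mathcal{E}_m$. To $X\subseteq\mathbf{R}^{\Rightarrow}$ associate the tuple $\langle n_1,\dots,n_m\rangle$ with $n_i=|\Delta_{m-i}\cap X|$;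 $X\gtrsim Y$ iff their tuples are equal or, at the first coordinate where they differ, the coordinate of $X$ is smaller. Standing assumption: $\mathbf{R}^{\Rightarrow}$ is coherent, i.e. no nonempty $X\subseteq\mathbf{R}^{\Rightarrow}$ has $\mathrm{m}(X)\models_{\mathrm{PL}}\bigwedge_{r\in X}\neg b(r)$. An $\mathbf{R}$-ordered model $M=(W,\succeq_N,\succeq_I,v)$ has a nonempty set $W$ of worlds, a valuation $v$, and $w_1\succeq_N w_2$ iff $F(w_1)\gtrsim F(w_2)$, where $F(w)=\{r\in\mathbf{R}^{\Rightarrow}: w\models b(r)\wedge\neg h(r)\}$ (Boolean truth at $w$ is given by $v$); $\succeq_I$ is the ideality ordering defined from $\mathbf{R}^{\mathrm{o}}$ (by $w_1\succeq_I w_2$ iff $V(w_1)\subseteq V(w_2)$ for the violation sets $V$). $w\succ_N u$ iff $w\succeq_N u$ and $u\not\succeq_N w$. For $X\subseteq W$, $\max_{\succeq_N}(X)=\{w\in X:\forall u\in X\,(u\succeq_N w\Rightarrow w\succeq_N u)\}$. $\Vert A\Vert$ is the set of worlds where $A$ holds. -}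

module Defs where

open import Data.Nat using (ℕ; zero; suc; _<_; _≤_; _∸_)
open import Data.Bool using (Bool; true; false; T; _∧_; _∨_; not)
open import Data.Fin using (Fin)
open import Data.Fin.Subset using (Subset; _∈_; _∩_; _─_; ∣_∣; Nonempty)
open import Data.Vec using (Vec; lookup; tabulate)
open import Data.List using (List; []; _∷_; applyUpTo)
open import Data.Product using (_×_; Σ; _,_)
open import Data.Sum using (_⊎_)
open import Data.Unit using (⊤)
open import Data.Empty using (⊥)
open import Relation.Nullary using (¬_)
open import Relation.Binary.PropositionalEquality using (_≡_)

data Fm : Set where
  var  : ℕ → Fm
  tt   : Fm
  ff   : Fm
  ~_   : Fm → Fm
  _&_  : Fm → Fm → Fm
  _∣∣_ : Fm → Fm → Fm
  _⇒_  : Fm → Fm → Fm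

Val : Set
Val = ℕ → Bool

⟦_⟧ : Fm → Val → Bool
⟦ var p ⟧ v = v p
⟦ tt ⟧ v = true
⟦ ff ⟧ v = false
⟦ ~ a ⟧ v = not (⟦ a ⟧ v)
⟦ a & b ⟧ v = ⟦ a ⟧ v ∧ ⟦ b ⟧ v
⟦ a ∣∣ b ⟧ v = ⟦ a ⟧ v ∨ ⟦ b ⟧ v
⟦ a ⇒ b ⟧ v = not (⟦ a ⟧ v) ∨ ⟦ b ⟧ v

-- Normality conditionals A ⇒ B and obligations ○(B/A): body A, head B.

record Rule : Set where
  constructor rule
  field
    body : Fm
    head : Fm
open Rule public

-- R = (R⇒ , Ro), R⇒ with n members indexed by Fin n, Ro with k members.
record RSet (n k : ℕ) : Set where
  constructor mkR
  field
    Rnorm : Vec Rule n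
    Robl  : Vec Rule k
open RSet public

module Ranking {n k : ℕ} (R : RSet n k) where

  b h : Fin n → Fm
  b i = body (lookup (Rnorm R) i)
  h i = head (lookup (Rnorm R) i)

  -- v satisfies every member of m(X) = { B → C : B ⇒ C ∈ X }
  SatM : Subset n → Val → Set
  SatM X v = ∀ i → i ∈ X → T (⟦ b i ⇒ h i ⟧ v)

  EntailsM : Subset n → Fm → Set
  EntailsM X φ = ∀ v → SatM X v → T (⟦ φ ⟧ v)

  EntailsNegBodies : Subset n → Set
  EntailsNegBodies X = ∀ v → SatM X v → ∀ i → i ∈ X → T (⟦ ~ b i ⟧ v)

  Coherent : Set
  Coherent = ∀ (X : Subset n) → Nonempty X → ¬ EntailsNegBodies X

  IsEps : Subset n → Subset n → Set
  IsEps X Y = ∀ i → (i ∈ Y → EntailsM X (~ b i)) × (EntailsM X (~ b i) → i ∈ Y)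

  IsESeq : (ℕ → Subset n) → Set
  IsESeq E = (E 0 ≡ Data.Fin.Subset.⊤) × (∀ i → IsEps (E i) (E (suc i)))

  Stable : (ℕ → Subset n) → ℕ → Set
  Stable E j = ∀ l → j < l → E l ≡ E j

  IsLeastStable : (ℕ → Subset n) → ℕ → Set
  IsLeastStable E m = Stable E m × (∀ j → Stable E j → m ≤ j)

  module Order (E : ℕ → Subset n) (m : ℕ) where

    Δ : ℕ → Subset n
    Δ i with i Data.Nat.<? m
    ... | Relation.Nullary.yes _ = E i ─ E (suc i)
    ... | Relation.Nullary.no  _ = E m

    -- ⟨n₁,…,n_m⟩ with n_i = |Δ_{m-i} ∩ X|  (entry j is n_{j+1})
    tuple : Subset n → List ℕ
    tuple X = applyUpTo (λ j → ∣ Δ (m ∸ suc j) ∩ X ∣) m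

    LexGeq : List ℕ → List ℕ → Set
    LexGeq [] [] = ⊤
    LexGeq (x ∷ xs) (y ∷ ys) = x < y ⊎ (x ≡ y × LexGeq xs ys)
    LexGeq _ _ = ⊥

    _≳_ : Subset n → Subset n → Set
    X ≳ Y = LexGeq (tuple X) (tuple Y)

    module Model (W : Set) (val : W → Val) where

      F : W → Subset n
      F w = tabulate (λ i → ⟦ b i ⟧ (val w) ∧ not (⟦ h i ⟧ (val w)))

      V : W → Subset k
      V w = tabulate (λ i → ⟦ body (lookup (Robl R) i) ⟧ (val w)
                         ∧ not (⟦ head (lookup (Robl R) i) ⟧ (val w)))

      _≽N_ : W → W → Set
      w₁ ≽N w₂ = F w₁ ≳ F w₂

      _≽I_ : W → W → Set
      w₁ ≽I w₂ = Data.Fin.Subset._⊆_ (V w₁) (V w₂)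

      _≻N_ : W → W → Set
      w ≻N u = (w ≽N u) × ¬ (u ≽N w)

      ‖_‖ : Fm → W → Set
      ‖ A ‖ w = T (⟦ A ⟧ (val w))

      InMaxN : (W → Set) → W → Set
      InMaxN X w = X w × (∀ u → X u → u ≽N w → w ≽N u)

{-# OPTIONS --safe #-}
-- Every world is ranked by a tuple of m naturals, and the strict lexicographic order on
-- tuples of one fixed length is well-founded (on lists of varying length it is not:
-- [1], [0,1], [0,0,1], … descends forever).  Hence ≽N is a preorder whose strict part
-- is well-founded, so climbing strictly upwards inside ‖A‖ from w₁ must stop, and
-- (classically) it stops at a ≽N-maximal world of ‖A‖.
module Submission where

open import Defs
open import Data.Nat using (ℕ; _<_)
open import Data.Nat.Properties using (suc-injective; <-trans; <-resp₂-≡)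
open import Data.Nat.Induction using () renaming (<-wellFounded to ℕ-<-wellFounded)
open import Data.Fin.Subset using (Subset)
open import Data.List using (List; []; _∷_; length)
open import Data.List.Properties using (length-applyUpTo)
open import Data.Vec using (Vec; fromList)
open import Data.Vec.Relation.Binary.Lex.Core using (length-equal)
open import Data.Vec.Relation.Binary.Lex.Strict using (Lex-<; this; next; <-wellFounded)
open import Data.Product using (Σ; ∃; _×_; _,_; proj₁)
open import Data.Sum using (_⊎_; inj₁; inj₂)
open import Data.Unit using (tt)
open import Function using (_on_)
open import Induction.WellFounded using (WellFounded; Acc; acc; module Subrelation)
open import Level using (Level; 0ℓ; _⊔_)
open import Axiom.ExcludedMiddle using (ExcludedMiddle)
open import Relation.Binary using (Rel; Transitive; _Respectsʳ_)
open import Relation.Binary.PropositionalEquality using (_≡_; refl; trans; sym)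
import Relation.Binary.Construct.On as On
open import Relation.Nullary using (¬_; yes; no; contradiction)
open import Relation.Nullary.Decidable using (decidable-stable)

module _ {a ℓ₁ ℓ₂ : Level} {A : Set a} {_≈_ : Rel A ℓ₁} {_≺_ : Rel A ℓ₂} where

  Lex-<-∃ : Rel (∃ (Vec A)) (a ⊔ ℓ₁ ⊔ ℓ₂)
  Lex-<-∃ (_ , xs) (_ , ys) = Lex-< _≈_ _≺_ xs ys

  Lex-<-∃-wellFounded : Transitive _≈_ → _≺_ Respectsʳ _≈_ → WellFounded _≺_ →
                        WellFounded Lex-<-∃
  Lex-<-∃-wellFounded ≈-trans ≺-respʳ ≺-wf (_ , xs) =
    accessible (<-wellFounded ≈-trans ≺-respʳ ≺-wf xs)
    where
    accessible : ∀ {n} {ys : Vec A n} → Acc (Lex-< _≈_ _≺_) ys → Acc Lex-<-∃ (n , ys)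
    accessibleBelow : ∀ {m n} {xs : Vec A m} {ys : Vec A n} →
                      (∀ {zs : Vec A n} → Lex-< _≈_ _≺_ zs ys → Acc (Lex-< _≈_ _≺_) zs) →
                      Lex-< _≈_ _≺_ xs ys → Acc Lex-<-∃ (m , xs)

    accessible (acc rs) = acc (accessibleBelow rs)
    -- Lex-< only relates vectors of equal length, so the length index can be unified away.
    accessibleBelow rs xs<ys with refl ← length-equal xs<ys = accessible (rs xs<ys)

-- LexGeq does not depend on R, E and m; Defs merely declares it inside Ranking.Order.
module _ {n k : ℕ} {R : RSet n k} {E : ℕ → Subset n} {m : ℕ} where
  open Ranking.Order R E m

  LexGeq-trans : Transitive LexGeq
  LexGeq-trans {[]}    {[]}    {[]}    _ _ = tt
  LexGeq-trans {_ ∷ _} {_ ∷ _} {_ ∷ _} (inj₁ x<y)         (inj₁ y<z)         = inj₁ (<-trans x<y y<z)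
  LexGeq-trans {_ ∷ _} {_ ∷ _} {_ ∷ _} (inj₁ x<y)         (inj₂ (refl , _))  = inj₁ x<y
  LexGeq-trans {_ ∷ _} {_ ∷ _} {_ ∷ _} (inj₂ (refl , _))  (inj₁ y<z)         = inj₁ y<z
  LexGeq-trans {_ ∷ _} {_ ∷ _} {_ ∷ _} (inj₂ (refl , p))  (inj₂ (refl , q))  = inj₂ (refl , LexGeq-trans p q)

  strictLexGeq⇒Lex-< : ∀ {xs ys} → length xs ≡ length ys → LexGeq xs ys → ¬ LexGeq ys xs →
                       Lex-< _≡_ _<_ (fromList xs) (fromList ys)
  strictLexGeq⇒Lex-< {[]}    {[]}    _ _ ys≱xs = contradiction tt ys≱xs
  strictLexGeq⇒Lex-< {_ ∷ _} {_ ∷ _} e (inj₁ x<y) _ = this x<y (suc-injective e)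
  strictLexGeq⇒Lex-< {_ ∷ _} {_ ∷ _} e (inj₂ (refl , xs≥ys)) ys≱xs =
    next refl (strictLexGeq⇒Lex-< (suc-injective e) xs≥ys (λ ys≥xs → ys≱xs (inj₂ (refl , ys≥xs))))

module _ {ℓ : Level} {W : Set ℓ} (_≽_ : Rel W ℓ) where

  StrictPart : Rel W ℓ
  StrictPart u w = u ≽ w × ¬ w ≽ u

  Maximal : (W → Set ℓ) → W → Set ℓ
  Maximal P w = P w × (∀ u → P u → u ≽ w → w ≽ u)

  StrictPart-trans : Transitive _≽_ → Transitive StrictPart
  StrictPart-trans ≽-trans (v≽u , u⋡v) (u≽w , w⋡u) =
    ≽-trans v≽u u≽w , λ w≽v → w⋡u (≽-trans w≽v v≽u)

  maximal-if-nothingStrictlyAbove : ExcludedMiddle ℓ → ∀ {P w} → P w →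
                                    ¬ (∃ λ u → P u × StrictPart u w) → Maximal P w
  maximal-if-nothingStrictlyAbove em Pw ∄u =
    Pw , λ u Pu u≽w → decidable-stable em (λ w⋡u → ∄u (u , Pu , u≽w , w⋡u))

  maximal-or-belowMaximal : ExcludedMiddle ℓ → Transitive _≽_ → WellFounded StrictPart →
                            ∀ P w → P w → Maximal P w ⊎ ∃ λ v → StrictPart v w × Maximal P v
  maximal-or-belowMaximal em ≽-trans wf P w = go (wf w)
    where
    go : ∀ {w} → Acc StrictPart w → P w → Maximal P w ⊎ ∃ λ v → StrictPart v w × Maximal P v
    go {w} (acc rs) Pw with em {∃ λ u → P u × StrictPart u w}
    ... | no ∄u = inj₁ (maximal-if-nothingStrictlyAbove em Pw ∄u)
    ... | yes (u , Pu , u≻w) with go (rs u≻w) Pu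
    ...   | inj₁ u-max              = inj₂ (u , u≻w , u-max)
    ...   | inj₂ (v , v≻u , v-max) = inj₂ (v , StrictPart-trans ≽-trans v≻u u≻w , v-max)

module _ {n k : ℕ} (R : RSet n k) (E : ℕ → Subset n) (m : ℕ) (W : Set) (val : W → Val) where
  open Ranking R
  open Order E m
  open Model W val

  ≽N-trans : Transitive _≽N_
  ≽N-trans = LexGeq-trans {R = R} {E} {m}

  ≻N-wellFounded : WellFounded _≻N_
  ≻N-wellFounded = Subrelation.wellFounded ≻N⇒Lex-<
    (On.wellFounded toVec (Lex-<-∃-wellFounded trans (proj₁ <-resp₂-≡) ℕ-<-wellFounded))
    where
    toVec : W → ∃ (Vec ℕ)
    toVec w = length (tuple (F w)) , fromList (tuple (F w))

    tuple-length : ∀ X → length (tuple X) ≡ m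
    tuple-length X = length-applyUpTo _ m

    ≻N⇒Lex-< : ∀ {u w} → u ≻N w → (Lex-<-∃ {_≈_ = _≡_} {_<_} on toVec) u w
    ≻N⇒Lex-< {u} {w} (u≽w , w⋡u) =
      strictLexGeq⇒Lex-< {R = R} {E} {m} (trans (tuple-length (F u)) (sym (tuple-length (F w)))) u≽w w⋡u

proposition1 : ExcludedMiddle 0ℓ →
    ∀ {n k : ℕ} (R : RSet n k) → Ranking.Coherent R →
    ∀ (E : ℕ → Subset n) (m : ℕ) → Ranking.IsESeq R E → Ranking.IsLeastStable R E m →
    ∀ (W : Set) (val : W → Val) (A : Fm) (w₁ : W) →
    Ranking.Order.Model.‖_‖ R E m W val A w₁ →
    Ranking.Order.Model.InMaxN R E m W val (Ranking.Order.Model.‖_‖ R E m W val A) w₁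
    ⊎ Σ W (λ w₂ → Ranking.Order.Model._≻N_ R E m W val w₂ w₁
                 × Ranking.Order.Model.InMaxN R E m W val (Ranking.Order.Model.‖_‖ R E m W val A) w₂)
proposition1 em R _ E m _ _ W val A =
  maximal-or-belowMaximal _ em (≽N-trans R E m W val) (≻N-wellFounded R E m W val)
    (Ranking.Order.Model.‖_‖ R E m W val A)
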